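{- Let $T$ be a tree of order $n\ge 2$ with $\ell(T)$ leaves. Then $\gamma_{tR2}(T)\ge \left\lceil \frac{2(n-\ell(T)+3)}{3}\right\rceil$. Moreover, equality holds when $T$ is a path, a star, or a double star.
   Context: A leaf is a vertex of degree one. A star is $K_{1,m}$; a double star is a tree with exactly two non-leaf vertices. For a graph $G$ and $f:V(G)\to\{0,1,2\}$ let $V_i=\{v:f(v)=i\}$; $f$ is a total Roman $\{2\}$-dominating function (TR2DF) if every vertex $v$ with $f(v)=0$ has a neighbor $u$ with $f(u)=2$ or two distinct neighbors $x,y$ with $f(x)=f(y)=1$, and the subgraph induced by $V_1\cup V_2$ has no isolated vertices. $\gamma_{tR2}(G)$ is the minimum weight $\sum_v f(v)$ of a TR2DF of $G$. -}

module Defs where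

open import Data.Nat using (ℕ; zero; suc; _+_; _*_; _≤_; _/_)
open import Data.Nat.Properties using ()
open import Data.Bool using (Bool; true; false)
open import Data.Fin using (Fin; toℕ)
open import Data.List using (List; []; _∷_; length; map; allFin)
open import Data.Nat.ListAction using (sum)
open import Data.Unit using (⊤)
open import Data.List.Relation.Unary.Unique.Propositional using (Unique)
open import Data.Product using (Σ; ∃; ∃-syntax; _×_; _,_)
open import Data.Sum using (_⊎_)
open import Data.Empty using (⊥)
open import Relation.Nullary using (¬_)
open import Relation.Binary.PropositionalEquality using (_≡_; _≢_)
open import Function.Bundles using (_⇔_)
open import Function.Definitions using (Injective)
import Data.Nat as ℕ

record Graph (n : ℕ) : Set where
  field
    adj    : Fin n → Fin n → Bool
    sym    : ∀ u v → adj u v ≡ adj v u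
    irrefl : ∀ v → adj v v ≡ false
open Graph public

Adj : ∀ {n} → Graph n → Fin n → Fin n → Set
Adj G u v = adj G u v ≡ true

countFin : ∀ {n} → (Fin n → Bool) → ℕ
countFin {n} p = sum (map (λ v → toB (p v)) (allFin n))
  where
  toB : Bool → ℕ
  toB true  = 1
  toB false = 0

degree : ∀ {n} → Graph n → Fin n → ℕ
degree G v = countFin (adj G v)

isLeafᵇ : ℕ → Bool
isLeafᵇ d = d ℕ.≡ᵇ 1

leaves : ∀ {n} → Graph n → ℕ
leaves G = countFin (λ v → isLeafᵇ (degree G v))

data Walk {n} (G : Graph n) : Fin n → Fin n → Set where
  here : ∀ {v} → Walk G v v
  step : ∀ {u w v} → Adj G u w → Walk G w v → Walk G u v

Connected : ∀ {n} → Graph n → Set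
Connected G = ∀ u v → Walk G u v

Chain : ∀ {n} → Graph n → List (Fin n) → Set
Chain G []             = ⊤
Chain G (x ∷ [])       = ⊤
Chain G (x ∷ y ∷ xs)   = Adj G x y × Chain G (y ∷ xs)

Cycle : ∀ {n} → Graph n → List (Fin n) → Set
Cycle G []       = ⊥
Cycle G (x ∷ xs) =
  3 ≤ length (x ∷ xs) × Unique (x ∷ xs) × Chain G (x ∷ xs) × LastAdj xs
  where
  LastAdj : List _ → Set
  LastAdj []           = ⊥
  LastAdj (y ∷ [])     = Adj G y x
  LastAdj (y ∷ z ∷ ys) = LastAdj (z ∷ ys)

Acyclic : ∀ {n} → Graph n → Set
Acyclic G = ∀ cs → ¬ Cycle G cs

IsTree : ∀ {n} → Graph n → Set
IsTree G = Connected G × Acyclic G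

IsPath : ∀ {n} → Graph n → Set
IsPath {n} G = Σ (Fin n → Fin n) λ σ → Injective _≡_ _≡_ σ ×
  (∀ i j → Adj G (σ i) (σ j) ⇔ (suc (toℕ i) ≡ toℕ j ⊎ suc (toℕ j) ≡ toℕ i))

IsStar : ∀ {n} → Graph n → Set
IsStar {n} G = Σ (Fin n) λ c →
  ∀ u v → Adj G u v ⇔ ((u ≡ c ⊎ v ≡ c) × u ≢ v)

IsDoubleStar : ∀ {n} → Graph n → Set
IsDoubleStar {n} G = IsTree G × Σ (Fin n) λ a → Σ (Fin n) λ b → a ≢ b ×
  (∀ v → (degree G v ≢ 1) ⇔ (v ≡ a ⊎ v ≡ b))

Labelling : ℕ → Set
Labelling n = Fin n → Fin 3

val : ∀ {n} → Labelling n → Fin n → ℕ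
val f v = toℕ (f v)

weight : ∀ {n} → Labelling n → ℕ
weight {n} f = sum (map (val f) (allFin n))

IsTR2DF : ∀ {n} → Graph n → Labelling n → Set
IsTR2DF {n} G f =
  (∀ v → val f v ≡ 0 →
     (∃[ u ] Adj G v u × val f u ≡ 2) ⊎
     (∃[ x ] ∃[ y ] x ≢ y × Adj G v x × Adj G v y × val f x ≡ 1 × val f y ≡ 1))
  ×
  -- G[V₁ ∪ V₂] has no isolated vertices
  (∀ v → val f v ≢ 0 → ∃[ u ] Adj G v u × val f u ≢ 0)

IsγtR2 : ∀ {n} → Graph n → ℕ → Set
IsγtR2 G k = (∃[ f ] IsTR2DF G f × weight f ≡ k) × (∀ f → IsTR2DF G f → k ≤ weight f)

-- ⌈ 2m / 3 ⌉ = ⌊ (2m + 2) / 3 ⌋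
ceil2over3 : ℕ → ℕ
ceil2over3 m = (2 * m + 2) / 3

module Submission where

-- Discharging. Give each vertex v the charge 3 f(v) + 3 deg(v) + 2 [v is a leaf], and let every
-- vertex labelled 1 send 1, and every vertex labelled 2 send 3, to each neighbour labelled 0.
-- Domination and totality leave every vertex with charge at least 8, so that
-- 8 n ≤ 3 w(f) + 3 Σ deg + 2 ℓ; in a forest Σ deg ≤ 2 (n - 1), whence 3 w(f) ≥ 2 (n - ℓ + 3).
-- The degree bound follows by repeatedly deleting a vertex with at most one remaining
-- neighbour, found at the end of a maximal path.  Paths (labelled 1 1 0 1 1 0 …), stars
-- (centre 2, one leaf 1) and double stars (both centres 2) carry labellings of that weight.

open import Defs hiding (sym)
open import Data.Bool using (Bool; true; false; not; _∧_; if_then_else_)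
import Data.Bool.Properties as Boolₚ
open import Data.Fin using (Fin; zero; suc; toℕ; punchOut; fromℕ; fromℕ<)
open import Data.Fin.Patterns using (0F; 1F; 2F)
import Data.Fin.Properties as Finₚ
open import Data.Fin.Permutation using (permutation)
open import Data.List using (List; []; _∷_; _++_; length; lookup; tabulate; map; allFin)
open import Data.List.Membership.Propositional using (_∉_)
open import Data.List.Membership.Propositional.Properties using (∈-lookup; ∈-∃++)
open import Data.List.Properties using (map-tabulate; length-++; ++-assoc)
open import Data.List.Relation.Unary.All using ([]; _∷_)
import Data.List.Relation.Unary.All as All
open import Data.List.Relation.Unary.All.Properties using (¬Any⇒All¬; ++⁻ˡ)
open import Data.List.Relation.Unary.AllPairs using ([]; _∷_)
open import Data.List.Relation.Unary.Any using (here; there)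
open import Data.List.Relation.Unary.Unique.Propositional using (Unique)
open import Data.Nat using (ℕ; zero; suc; _+_; _*_; _∸_; _/_; _≤_; _<_; _≟_; _≤ᵇ_; z≤n; s≤s; s≤s⁻¹)
import Data.Nat.ListAction as List
open import Data.Nat.DivMod using (m<n*o⇒m/o<n; m*n/n≡m; /-monoˡ-≤)
open import Data.Nat.Properties
open import Data.Nat.Tactic.RingSolver using (solve-∀)
open import Data.Product using (_×_; _,_; proj₁; proj₂; ∃; ∃-syntax)
open import Data.Sum using (_⊎_; inj₁; inj₂; [_,_])
open import Data.Unit using (tt)
open import Function using (_∘_; id)
open import Function.Bundles using (Equivalence; _⇔_)
open import Function.Definitions using (Injective)
open import Relation.Binary.PropositionalEquality
  using (_≡_; _≢_; refl; sym; trans; cong; cong₂; subst; subst₂; module ≡-Reasoning)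
open import Relation.Nullary using (Dec; yes; no; does; ¬_; ¬?; contradiction; decidable-stable)
open import Relation.Nullary.Decidable using (_×-dec_)
open import Algebra.Properties.CommutativeMonoid.Sum +-0-commutativeMonoid
  using (sum; sum-syntax; sum-cong-≗; sum-replicate-zero; ∑-distrib-+; ∑-comm; ∑-permute)

𝟙 : Bool → ℕ
𝟙 true  = 1
𝟙 false = 0

𝟙≤1 : ∀ b → 𝟙 b ≤ 1
𝟙≤1 true  = ≤-refl
𝟙≤1 false = z≤n

𝟙-∧ : ∀ a b → 𝟙 (a ∧ b) ≡ 𝟙 a * 𝟙 b
𝟙-∧ true  b = sym (*-identityˡ (𝟙 b))
𝟙-∧ false b = refl

𝟙-∧-≤ : ∀ a b → 𝟙 (a ∧ b) ≤ 𝟙 a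
𝟙-∧-≤ true  b = 𝟙≤1 b
𝟙-∧-≤ false b = z≤n

𝟙-complement : ∀ b → 𝟙 b + 𝟙 (not b) ≡ 1
𝟙-complement true  = refl
𝟙-complement false = refl

∧-true⁻ : ∀ {a b} → a ∧ b ≡ true → a ≡ true × b ≡ true
∧-true⁻ {true} {true} _ = refl , refl

*-identityʳ-≤ : ∀ m {k} → k ≤ 1 → m * k ≤ m
*-identityʳ-≤ m k≤1 = subst (m * _ ≤_) (*-identityʳ m) (*-monoʳ-≤ m k≤1)

∑-mono-≤ : ∀ {n} {g h : Fin n → ℕ} → (∀ i → g i ≤ h i) → sum g ≤ sum h
∑-mono-≤ {zero}  g≤h = z≤n
∑-mono-≤ {suc n} g≤h = +-mono-≤ (g≤h zero) (∑-mono-≤ (g≤h ∘ suc))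

∑-mono-< : ∀ {n} {g h : Fin n → ℕ} → (∀ i → g i ≤ h i) → ∀ j → g j < h j → sum g < sum h
∑-mono-< g≤h zero    gj<hj = +-mono-<-≤ gj<hj (∑-mono-≤ (g≤h ∘ suc))
∑-mono-< g≤h (suc j) gj<hj = +-mono-≤-< (g≤h zero) (∑-mono-< (g≤h ∘ suc) j gj<hj)

∑-const : ∀ n c → ∑[ i < n ] c ≡ n * c
∑-const zero    c = refl
∑-const (suc n) c = cong (c +_) (∑-const n c)

∑-*ˡ : ∀ {n} c (g : Fin n → ℕ) → ∑[ i < n ] (c * g i) ≡ c * sum g
∑-*ˡ {zero}  c g = sym (*-zeroʳ c)
∑-*ˡ {suc n} c g = trans (cong (c * g zero +_) (∑-*ˡ c (g ∘ suc))) (sym (*-distribˡ-+ c _ _))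

∑-≥-term : ∀ {n} (g : Fin n → ℕ) i → g i ≤ sum g
∑-≥-term g zero    = m≤m+n _ _
∑-≥-term g (suc i) = ≤-trans (∑-≥-term (g ∘ suc) i) (m≤n+m _ _)

∑-≥-pair : ∀ {n} (g : Fin n → ℕ) {i j} → i ≢ j → g i + g j ≤ sum g
∑-≥-pair g {zero}  {zero}  i≢j = contradiction refl i≢j
∑-≥-pair g {zero}  {suc j} _   = +-monoʳ-≤ (g zero) (∑-≥-term (g ∘ suc) j)
∑-≥-pair g {suc i} {zero}  _   = subst (_≤ sum g) (+-comm (g zero) _) (+-monoʳ-≤ (g zero) (∑-≥-term (g ∘ suc) i))
∑-≥-pair g {suc i} {suc j} i≢j = ≤-trans (∑-≥-pair (g ∘ suc) (i≢j ∘ cong suc)) (m≤n+m _ _)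

∑-pick : ∀ {n} (v : Fin n) (g : Fin n → ℕ) → ∑[ w < n ] (𝟙 (does (w Finₚ.≟ v)) * g w) ≡ g v
∑-pick {suc n} zero    g = trans (cong₂ _+_ (+-identityʳ (g zero)) (sum-replicate-zero n)) (+-identityʳ (g zero))
∑-pick {suc n} (suc v) g = ∑-pick v (g ∘ suc)

∑-vanishing : ∀ {n} (p : Fin n → Bool) (g : Fin n → ℕ) → (∀ i → p i ≡ false) →
              ∑[ i < n ] (𝟙 (p i) * g i) ≡ 0
∑-vanishing {n} p g none = trans (sum-cong-≗ {n} (λ i → cong (λ b → 𝟙 b * g i) (none i))) (sum-replicate-zero n)

∑-swap-symmetric : ∀ {n} (a : Fin n → Fin n → ℕ) → (∀ u v → a u v ≡ a v u) → (g h : Fin n → ℕ) →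
  ∑[ v < n ] (g v * ∑[ u < n ] (a v u * h u)) ≡ ∑[ v < n ] (h v * ∑[ u < n ] (a v u * g u))
∑-swap-symmetric {n} a a-sym g h = begin
  ∑[ v < n ] (g v * ∑[ u < n ] (a v u * h u))   ≡⟨ sum-cong-≗ {n} (λ v → ∑-*ˡ {n} (g v) _) ⟨
  ∑[ v < n ] ∑[ u < n ] (g v * (a v u * h u))   ≡⟨ ∑-comm {n} {n} _ ⟩
  ∑[ u < n ] ∑[ v < n ] (g v * (a v u * h u))   ≡⟨ sum-cong-≗ {n} (λ u → sum-cong-≗ {n} (regroup u)) ⟩
  ∑[ u < n ] ∑[ v < n ] (h u * (a u v * g v))   ≡⟨ sum-cong-≗ {n} (λ u → ∑-*ˡ {n} (h u) _) ⟩
  ∑[ u < n ] (h u * ∑[ v < n ] (a u v * g v))   ∎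
  where
  open ≡-Reasoning
  regroup : ∀ u v → g v * (a v u * h u) ≡ h u * (a u v * g v)
  regroup u v = trans (cong (λ e → g v * (e * h u)) (a-sym v u)) (swap (g v) (a u v) (h u))
    where
    swap : ∀ x y z → x * (y * z) ≡ z * (y * x)
    swap = solve-∀

sum-tabulate : ∀ {n} (g : Fin n → ℕ) → List.sum (tabulate g) ≡ sum g
sum-tabulate {zero}  g = refl
sum-tabulate {suc n} g = cong (g zero +_) (sum-tabulate (g ∘ suc))

sum-allFin : ∀ {n} (g : Fin n → ℕ) → List.sum (map g (allFin n)) ≡ sum g
sum-allFin g = trans (cong List.sum (map-tabulate id g)) (sum-tabulate g)

count : ∀ {n} → (Fin n → Bool) → ℕ
count {n} p = ∑[ i < n ] 𝟙 (p i)

-- `countFin` uses an indicator local to `Defs`; a one-vertex count exposes it.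
countFin-single : ∀ b → countFin {1} (λ _ → b) ≡ 𝟙 b + 0
countFin-single true  = refl
countFin-single false = refl

countFin≡count : ∀ {n} (p : Fin n → Bool) → countFin p ≡ count p
countFin≡count {n} p = trans (sum-allFin {n} _) (sum-cong-≗ λ i → +-cancelʳ-≡ 0 _ _ (countFin-single (p i)))

count-all : ∀ n → count {n} (λ _ → true) ≡ n
count-all n = trans (∑-const n 1) (*-identityʳ n)

count-complement : ∀ {n} (p : Fin n → Bool) → count p + count (not ∘ p) ≡ n
count-complement {n} p = begin
  count p + count (not ∘ p)             ≡⟨ ∑-distrib-+ (𝟙 ∘ p) (𝟙 ∘ not ∘ p) ⟨
  ∑[ i < n ] (𝟙 (p i) + 𝟙 (not (p i)))  ≡⟨ sum-cong-≗ (𝟙-complement ∘ p) ⟩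
  count {n} (λ _ → true)                ≡⟨ count-all n ⟩
  n                                     ∎
  where open ≡-Reasoning

count-witness : ∀ {n} (p : Fin n → Bool) → 1 ≤ count p → ∃ λ i → p i ≡ true
count-witness {suc n} p 1≤count with p zero in p0
... | true  = zero , p0
... | false = let i , pi = count-witness (p ∘ suc) 1≤count in suc i , pi

count≡0⇒none : ∀ {n} (p : Fin n → Bool) → count p ≡ 0 → ∀ i → p i ≡ false
count≡0⇒none p count≡0 i with p i in pi
... | false = refl
... | true  = contradiction (subst₂ _≤_ (cong 𝟙 pi) count≡0 (∑-≥-term (𝟙 ∘ p) i)) λ ()

count-singleton : ∀ {n} (a : Fin n) → count (λ i → does (i Finₚ.≟ a)) ≡ 1
count-singleton {n} a = trans (sum-cong-≗ {n} (λ i → sym (*-identityʳ _))) (∑-pick a (λ _ → 1))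

count-≤-1 : ∀ {n} (p : Fin n → Bool) a → (∀ {i} → p i ≡ true → i ≡ a) → count p ≤ 1
count-≤-1 p a only-a = ≤-trans (∑-mono-≤ below) (≤-reflexive (count-singleton a))
  where
  below : ∀ i → 𝟙 (p i) ≤ 𝟙 (does (i Finₚ.≟ a))
  below i with p i in pi | i Finₚ.≟ a
  ... | false | _      = z≤n
  ... | true  | yes _  = ≤-refl
  ... | true  | no i≢a = contradiction (only-a pi) i≢a

count-≤-2 : ∀ {n} (p : Fin n → Bool) a b → (∀ {i} → p i ≡ true → i ≡ a ⊎ i ≡ b) → count p ≤ 2
count-≤-2 {n} p a b only-ab = begin
  count p
    ≤⟨ ∑-mono-≤ below ⟩
  ∑[ i < n ] (𝟙 (does (i Finₚ.≟ a)) + 𝟙 (does (i Finₚ.≟ b)))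
    ≡⟨ ∑-distrib-+ {n} _ _ ⟩
  count (λ i → does (i Finₚ.≟ a)) + count (λ i → does (i Finₚ.≟ b))
    ≡⟨ cong₂ _+_ (count-singleton a) (count-singleton b) ⟩
  2
    ∎
  where
  open ≤-Reasoning
  below : ∀ i → 𝟙 (p i) ≤ 𝟙 (does (i Finₚ.≟ a)) + 𝟙 (does (i Finₚ.≟ b))
  below i with p i in pi | i Finₚ.≟ a | i Finₚ.≟ b
  ... | false | _      | _      = z≤n
  ... | true  | yes _  | _      = m≤m+n 1 _
  ... | true  | no _   | yes _  = ≤-refl
  ... | true  | no i≢a | no i≢b with only-ab pi
  ...   | inj₁ i≡a = contradiction i≡a i≢a
  ...   | inj₂ i≡b = contradiction i≡b i≢b

isLeafᵇ-≢1 : ∀ {d} → d ≢ 1 → isLeafᵇ d ≡ false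
isLeafᵇ-≢1 {zero}        _   = refl
isLeafᵇ-≢1 {suc zero}    d≢1 = contradiction refl d≢1
isLeafᵇ-≢1 {suc (suc _)} _   = refl

another-vertex : ∀ {n} → 2 ≤ n → (v : Fin n) → ∃ λ w → w ≢ v
another-vertex (s≤s (s≤s _)) zero    = 1F , λ ()
another-vertex (s≤s (s≤s _)) (suc _) = 0F , λ ()

module _ {n} {G : Graph n} where

  Adj-sym : ∀ {u v} → Adj G u v → Adj G v u
  Adj-sym {u} {v} uv = trans (Graph.sym G v u) uv

  Adj⇒≢ : ∀ {u v} → Adj G u v → u ≢ v
  Adj⇒≢ {u} uv refl = contradiction (trans (sym uv) (irrefl G u)) λ ()

  degree≡∑adj : ∀ v → degree G v ≡ ∑[ u < n ] 𝟙 (adj G v u)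
  degree≡∑adj v = countFin≡count (adj G v)

  degree-≥1 : ∀ {v u} → Adj G v u → 1 ≤ degree G v
  degree-≥1 {v} {u} vu = subst₂ _≤_ (cong 𝟙 vu) (sym (degree≡∑adj v)) (∑-≥-term (𝟙 ∘ adj G v) u)

  degree-≥2 : ∀ {v x y} → Adj G v x → Adj G v y → x ≢ y → 2 ≤ degree G v
  degree-≥2 {v} {x} {y} vx vy x≢y = begin
    2                               ≡⟨ cong₂ _+_ (cong 𝟙 vx) (cong 𝟙 vy) ⟨
    𝟙 (adj G v x) + 𝟙 (adj G v y)   ≤⟨ ∑-≥-pair (𝟙 ∘ adj G v) x≢y ⟩
    ∑[ u < n ] 𝟙 (adj G v u)        ≡⟨ degree≡∑adj v ⟨
    degree G v                      ∎
    where open ≤-Reasoning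

  leaf-neighbour-unique : ∀ {v x y} → degree G v ≡ 1 → Adj G v x → Adj G v y → x ≡ y
  leaf-neighbour-unique {x = x} {y} leaf vx vy with x Finₚ.≟ y
  ... | yes x≡y = x≡y
  ... | no  x≢y = contradiction leaf (>⇒≢ (degree-≥2 vx vy x≢y))

  walk-closed : (P : Fin n → Set) → (∀ {x y} → P x → Adj G x y → P y) →
                ∀ {x y} → P x → Walk G x y → P y
  walk-closed P closed Px here         = Px
  walk-closed P closed Px (step xw wy) = walk-closed P closed (closed Px xw) wy

  has-neighbour : Connected G → 2 ≤ n → ∀ v → ∃ λ u → Adj G v u
  has-neighbour connected 2≤n v with another-vertex 2≤n v
  ... | w , w≢v with connected v w
  ...   | here              = contradiction refl w≢v
  ...   | step {w = u} vu _ = u , vu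

  nonleaves : ℕ
  nonleaves = count (not ∘ isLeafᵇ ∘ degree G)

  leaves+nonleaves : leaves G + nonleaves ≡ n
  leaves+nonleaves = trans (cong (_+ nonleaves) (countFin≡count {n} _)) (count-complement (isLeafᵇ ∘ degree G))

  leaves-≤ : leaves G ≤ n
  leaves-≤ = subst (leaves G ≤_) leaves+nonleaves (m≤m+n _ _)

  leaves+1≤n : ∀ {a} → degree G a ≢ 1 → leaves G + 1 ≤ n
  leaves+1≤n {a} a-inner = subst (leaves G + 1 ≤_) leaves+nonleaves (+-monoʳ-≤ (leaves G)
    (subst (λ b → 𝟙 (not b) ≤ nonleaves) (isLeafᵇ-≢1 a-inner)
      (∑-≥-term (𝟙 ∘ not ∘ isLeafᵇ ∘ degree G) a)))

  leaves+2≤n : ∀ {a b} → a ≢ b → degree G a ≢ 1 → degree G b ≢ 1 → leaves G + 2 ≤ n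
  leaves+2≤n {a} {b} a≢b a-inner b-inner = subst (leaves G + 2 ≤_) leaves+nonleaves (+-monoʳ-≤ (leaves G)
    (subst₂ (λ x y → 𝟙 (not x) + 𝟙 (not y) ≤ nonleaves) (isLeafᵇ-≢1 a-inner) (isLeafᵇ-≢1 b-inner)
      (∑-≥-pair (𝟙 ∘ not ∘ isLeafᵇ ∘ degree G) a≢b)))

Dominated : ∀ {n} → Graph n → Labelling n → Fin n → Set
Dominated G f v = (∃[ u ] Adj G v u × val f u ≡ 2) ⊎
                  (∃[ x ] ∃[ y ] x ≢ y × Adj G v x × Adj G v y × val f x ≡ 1 × val f y ≡ 1)

Supported : ∀ {n} → Graph n → Labelling n → Fin n → Set
Supported G f v = ∃[ u ] Adj G v u × val f u ≢ 0

leaf : ℕ → ℕ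
leaf d = 𝟙 (isLeafᵇ d)

isZeroᵇ : Fin 3 → Bool
isZeroᵇ zero    = true
isZeroᵇ (suc _) = false

isZeroᵇ-nonzero : ∀ {x : Fin 3} → toℕ x ≢ 0 → isZeroᵇ x ≡ false
isZeroᵇ-nonzero {zero}  x≢0 = contradiction refl x≢0
isZeroᵇ-nonzero {suc _} _   = refl

-- What a vertex with this label sends to each neighbour labelled 0.
share : Fin 3 → ℕ
share zero             = 0
share (suc zero)       = 1
share (suc (suc zero)) = 3

share-of-1 : ∀ {x : Fin 3} → toℕ x ≡ 1 → share x ≡ 1
share-of-1 {suc zero} refl = refl

share-of-2 : ∀ {x : Fin 3} → toℕ x ≡ 2 → share x ≡ 3
share-of-2 {suc (suc zero)} refl = refl

charge-of-0-≥8 : ∀ {d r} → (1 ≤ d × 3 ≤ r) ⊎ (2 ≤ d × 2 ≤ r) → 8 ≤ 3 * d + 2 * leaf d + r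
charge-of-0-≥8 {suc zero}    (inj₁ (_ , 3≤r))    = +-monoʳ-≤ 5 3≤r
charge-of-0-≥8 {suc zero}    (inj₂ (s≤s () , _))
charge-of-0-≥8 {suc (suc d)} received = +-mono-≤ (m≤n⇒m≤n+o 0 (*-monoʳ-≤ 3 (m≤m+n 2 d))) (2≤r received)
  where
  2≤r : ∀ {r} → (1 ≤ suc (suc d) × 3 ≤ r) ⊎ (2 ≤ suc (suc d) × 2 ≤ r) → 2 ≤ r
  2≤r (inj₁ (_ , 3≤r)) = ≤-trans (n≤1+n 2) 3≤r
  2≤r (inj₂ (_ , 2≤r)) = 2≤r

charge-of-nonzero-≥8 : ∀ x {z d} → z < d → 8 + share (suc x) * z ≤ 3 * toℕ (suc x) + 3 * d + 2 * leaf d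
charge-of-nonzero-≥8 zero       {d = suc zero}    (s≤s z≤n) = ≤-refl
charge-of-nonzero-≥8 (suc zero) {d = suc zero}    (s≤s z≤n) = m≤m+n 8 3
charge-of-nonzero-≥8 zero       {z} {suc (suc d)} (s≤s z≤1+d) = begin
  8 + 1 * z                  ≡⟨ cong (8 +_) (*-identityˡ z) ⟩
  8 + z                      ≤⟨ +-monoʳ-≤ 8 z≤1+d ⟩
  9 + d                      ≤⟨ +-monoʳ-≤ 9 (m≤m+n d (2 * d)) ⟩
  9 + 3 * d                  ≡⟨ regroup d ⟩
  3 + 3 * (2 + d) + 2 * 0    ∎
  where
  open ≤-Reasoning
  regroup : ∀ d → 9 + 3 * d ≡ 3 + 3 * (2 + d) + 2 * 0
  regroup = solve-∀
charge-of-nonzero-≥8 (suc zero) {z} {suc (suc d)} (s≤s z≤1+d) = begin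
  8 + 3 * z                  ≤⟨ +-monoʳ-≤ 8 (*-monoʳ-≤ 3 z≤1+d) ⟩
  8 + 3 * (1 + d)            ≤⟨ n≤1+n _ ⟩
  1 + (8 + 3 * (1 + d))      ≡⟨ regroup d ⟩
  6 + 3 * (2 + d) + 2 * 0    ∎
  where
  open ≤-Reasoning
  regroup : ∀ d → 1 + (8 + 3 * (1 + d)) ≡ 6 + 3 * (2 + d) + 2 * 0
  regroup = solve-∀

module Discharging {n} (G : Graph n) (f : Labelling n) where

  edge : Fin n → Fin n → ℕ
  edge u v = 𝟙 (adj G u v)

  initial : Fin n → ℕ
  initial v = 3 * val f v + 3 * degree G v + 2 * leaf (degree G v)

  sent : Fin n → ℕ
  sent v = share (f v) * ∑[ u < n ] (edge v u * 𝟙 (isZeroᵇ (f u)))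

  received : Fin n → ℕ
  received v = 𝟙 (isZeroᵇ (f v)) * ∑[ u < n ] (edge v u * share (f u))

  ∑sent≡∑received : sum sent ≡ sum received
  ∑sent≡∑received =
    ∑-swap-symmetric edge (λ u v → cong 𝟙 (Graph.sym G u v)) (share ∘ f) (𝟙 ∘ isZeroᵇ ∘ f)

  final-charge-≥8 : IsTR2DF G f → ∀ v → 8 + sent v ≤ initial v + received v
  final-charge-≥8 (dominated , supported) v with f v in fv
  ... | zero  = subst (λ t → 8 ≤ 3 * degree G v + 2 * leaf (degree G v) + t) (sym (*-identityˡ R))
                  (charge-of-0-≥8 (from-neighbours (dominated v (cong toℕ fv))))
    where
    R = ∑[ u < n ] (edge v u * share (f u))
    from-neighbours : Dominated G f v → (1 ≤ degree G v × 3 ≤ R) ⊎ (2 ≤ degree G v × 2 ≤ R)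
    from-neighbours (inj₁ (u , vu , fu≡2)) =
      inj₁ (degree-≥1 {G = G} vu , subst (_≤ R) (cong₂ _*_ (cong 𝟙 vu) (share-of-2 fu≡2)) (∑-≥-term _ u))
    from-neighbours (inj₂ (x , y , x≢y , vx , vy , fx≡1 , fy≡1)) =
      inj₂ (degree-≥2 {G = G} vx vy x≢y ,
            subst (_≤ R) (cong₂ _+_ (cong₂ _*_ (cong 𝟙 vx) (share-of-1 fx≡1))
                                    (cong₂ _*_ (cong 𝟙 vy) (share-of-1 fy≡1)))
                         (∑-≥-pair _ x≢y))
  ... | suc x = subst (8 + share (suc x) * Z ≤_) (sym (+-identityʳ _))
                  (charge-of-nonzero-≥8 x (subst (Z <_) (sym (degree≡∑adj {G = G} v)) Z<∑edge))
    where
    Z = ∑[ u < n ] (edge v u * 𝟙 (isZeroᵇ (f u)))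
    Z<∑edge : Z < ∑[ u < n ] edge v u
    Z<∑edge with supported v (λ fv≡0 → contradiction (trans (sym (cong toℕ fv)) fv≡0) λ ())
    ... | u , vu , fu≢0 = ∑-mono-< (λ w → *-identityʳ-≤ (edge v w) (𝟙≤1 _)) u
                            (subst₂ (λ e z → e * 𝟙 z < e) (sym (cong 𝟙 vu)) (sym (isZeroᵇ-nonzero fu≢0))
                                    ≤-refl)

  ∑initial : sum initial ≡ 3 * weight f + 3 * ∑[ v < n ] degree G v + 2 * leaves G
  ∑initial = begin
    sum initial
      ≡⟨ ∑-distrib-+ {n} _ _ ⟩
    ∑[ v < n ] (3 * val f v + 3 * degree G v) + ∑[ v < n ] (2 * leaf (degree G v))
      ≡⟨ cong (_+ _) (∑-distrib-+ {n} _ _) ⟩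
    ∑[ v < n ] (3 * val f v) + ∑[ v < n ] (3 * degree G v) + ∑[ v < n ] (2 * leaf (degree G v))
      ≡⟨ cong₂ _+_ (cong₂ _+_ (∑-*ˡ 3 (val f)) (∑-*ˡ 3 (degree G))) (∑-*ˡ 2 (leaf ∘ degree G)) ⟩
    3 * sum (val f) + 3 * ∑[ v < n ] degree G v + 2 * count (isLeafᵇ ∘ degree G)
      ≡⟨ cong₂ (λ w l → 3 * w + 3 * ∑[ v < n ] degree G v + 2 * l)
               (sum-allFin {n} (val f)) (countFin≡count {n} _) ⟨
    3 * weight f + 3 * ∑[ v < n ] degree G v + 2 * leaves G
      ∎
    where open ≡-Reasoning

  charge-inequality : IsTR2DF G f → 8 * n ≤ 3 * weight f + 3 * ∑[ v < n ] degree G v + 2 * leaves G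
  charge-inequality isTR2DF = +-cancelʳ-≤ (sum received) _ _ (begin
    8 * n + sum received
      ≡⟨ cong₂ _+_ (trans (*-comm 8 n) (sym (∑-const n 8))) (sym ∑sent≡∑received) ⟩
    ∑[ v < n ] 8 + sum sent             ≡⟨ ∑-distrib-+ {n} _ _ ⟨
    ∑[ v < n ] (8 + sent v)             ≤⟨ ∑-mono-≤ (final-charge-≥8 isTR2DF) ⟩
    ∑[ v < n ] (initial v + received v) ≡⟨ ∑-distrib-+ {n} _ _ ⟩
    sum initial + sum received          ≡⟨ cong (_+ sum received) ∑initial ⟩
    3 * weight f + 3 * ∑[ v < n ] degree G v + 2 * leaves G + sum received ∎)
    where open ≤-Reasoning

unique-lookup-injective : ∀ {A : Set} {xs : List A} → Unique xs → Injective _≡_ _≡_ (lookup xs)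
unique-lookup-injective (_ ∷ _)         {zero}  {zero}  _  = refl
unique-lookup-injective (x∉xs ∷ _)      {zero}  {suc j} eq = contradiction eq (All.lookup x∉xs (∈-lookup j))
unique-lookup-injective (x∉xs ∷ _)      {suc i} {zero}  eq = contradiction (sym eq) (All.lookup x∉xs (∈-lookup i))
unique-lookup-injective (_ ∷ unique)    {suc i} {suc j} eq = cong suc (unique-lookup-injective unique eq)

unique-length : ∀ {n} {xs : List (Fin n)} → Unique xs → length xs ≤ n
unique-length unique = Finₚ.injective⇒≤ (unique-lookup-injective unique)

unique-++⁻ˡ : ∀ {A : Set} (xs : List A) {ys} → Unique (xs ++ ys) → Unique xs
unique-++⁻ˡ []       _             = []
unique-++⁻ˡ (x ∷ xs) (x∉ ∷ unique) = ++⁻ˡ xs x∉ ∷ unique-++⁻ˡ xs unique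

module _ {n} {G : Graph n} where

  chain-++⁻ˡ : ∀ (xs : List (Fin n)) {ys} → Chain G (xs ++ ys) → Chain G xs
  chain-++⁻ˡ []           _            = tt
  chain-++⁻ˡ (x ∷ [])     _            = tt
  chain-++⁻ˡ (x ∷ y ∷ xs) (xy , chain) = xy , chain-++⁻ˡ (y ∷ xs) chain

  -- `Cycle` keeps its closing condition (the last vertex is adjacent to the first) local;
  -- its type is recovered by inference from the last component of a cycle.
  ClosingEdge : Fin n → List (Fin n) → Set
  ClosingEdge x = typeOfLast (λ xs (c : Cycle G (x ∷ xs)) → proj₂ (proj₂ (proj₂ c)))
    where
    typeOfLast : {C : List (Fin n) → Set} → ((xs : List (Fin n)) → Cycle G (x ∷ xs) → C xs) → List (Fin n) → Set
    typeOfLast {C} _ = C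

  closingEdge-snoc : ∀ {x} s r w → Adj G w x → ClosingEdge x (s ∷ r ++ w ∷ [])
  closingEdge-snoc s []      w wx = wx
  closingEdge-snoc s (t ∷ r) w wx = closingEdge-snoc t r w wx

  chord⇒cycle : ∀ e s r₁ w r₂ → Unique (e ∷ s ∷ r₁ ++ w ∷ r₂) → Chain G (e ∷ s ∷ r₁ ++ w ∷ r₂) →
                Adj G e w → Cycle G (e ∷ s ∷ r₁ ++ w ∷ [])
  chord⇒cycle e s r₁ w r₂ unique chain ew =
    3≤length , unique-++⁻ˡ cycle (subst Unique split unique) , chain-++⁻ˡ cycle (subst (Chain G) split chain) ,
    closingEdge-snoc s r₁ w (Adj-sym {G = G} ew)
    where
    cycle = e ∷ s ∷ r₁ ++ w ∷ []
    split : e ∷ s ∷ r₁ ++ w ∷ r₂ ≡ cycle ++ r₂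
    split = cong (λ t → e ∷ s ∷ t) (sym (++-assoc r₁ (w ∷ []) r₂))
    3≤length : 3 ≤ length cycle
    3≤length = s≤s (s≤s (subst (1 ≤_) (sym (length-++ r₁)) (m≤n+m 1 (length r₁))))

module Forest {n} {G : Graph n} (acyclic : Acyclic G) where

  open import Data.List.Membership.DecPropositional (Finₚ._≟_ {n}) using (_∈?_)

  degreeIn : (Fin n → Bool) → Fin n → ℕ
  degreeIn A u = ∑[ w < n ] (𝟙 (A w) * 𝟙 (adj G u w))

  module Exploration (A : Fin n → Bool) where

    Extendable : Fin n → List (Fin n) → Set
    Extendable e path = ∃ λ w → A w ≡ true × Adj G e w × w ∉ path

    extendable? : ∀ e path → Dec (Extendable e path)
    extendable? e path =
      Finₚ.any? λ w → (A w Boolₚ.≟ true) ×-dec (adj G e w Boolₚ.≟ true) ×-dec ¬? (w ∈? path)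

    next : Fin n → List (Fin n) → Fin n
    next e []      = e
    next e (s ∷ _) = s

    -- Any other neighbour of the end of a maximal path would close a cycle.
    maximal-end : ∀ e q → Unique (e ∷ q) → Chain G (e ∷ q) → ¬ Extendable e (e ∷ q) →
                  ∀ {w} → A w ≡ true → Adj G e w → w ≡ next e q
    maximal-end e q unique chain maximal {w} Aw ew
      with decidable-stable (w ∈? e ∷ q) (λ w∉ → maximal (w , Aw , ew , w∉))
    ... | here w≡e = contradiction (sym w≡e) (Adj⇒≢ {G = G} ew)
    maximal-end e (s ∷ r) unique chain maximal Aw ew | there (here w≡s) = w≡s
    maximal-end e (s ∷ r) unique chain maximal {w} Aw ew | there (there w∈r) with ∈-∃++ w∈r
    ... | r₁ , r₂ , refl = contradiction (chord⇒cycle e s r₁ w r₂ unique chain ew) (acyclic _)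

    -- The simple path e ∷ q in A grows at e; it has at most n vertices, so the fuel k never runs out.
    explore : ∀ k e q → n ≤ length (e ∷ q) + k → Unique (e ∷ q) → Chain G (e ∷ q) → A e ≡ true →
              ∃ λ v → A v ≡ true × degreeIn A v ≤ 1
    explore k e q fuel unique chain Ae with extendable? e (e ∷ q)
    ... | no maximal = e , Ae , (begin
      degreeIn A e                    ≡⟨ sum-cong-≗ {n} (λ w → 𝟙-∧ (A w) (adj G e w)) ⟨
      count (λ w → A w ∧ adj G e w)   ≤⟨ count-≤-1 _ (next e q) end ⟩
      1                               ∎)
      where
      open ≤-Reasoning
      end : ∀ {w} → (A w ∧ adj G e w) ≡ true → w ≡ next e q
      end Aw∧ew = maximal-end e q unique chain maximal (proj₁ (∧-true⁻ Aw∧ew)) (proj₂ (∧-true⁻ Aw∧ew))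
    ... | yes (w , Aw , ew , w∉) = extend k fuel
      where
      unique′ : Unique (w ∷ e ∷ q)
      unique′ = ¬Any⇒All¬ _ w∉ ∷ unique
      extend : ∀ k → n ≤ length (e ∷ q) + k → ∃ λ v → A v ≡ true × degreeIn A v ≤ 1
      extend zero    fuel = contradiction (≤-trans (unique-length unique′) (subst (n ≤_) (+-identityʳ _) fuel))
                                          (<-irrefl refl)
      extend (suc k) fuel = explore k w (e ∷ q) (subst (n ≤_) (+-suc _ k) fuel) unique′ (Adj-sym {G = G} ew , chain) Aw

    vertex-of-degreeIn-≤1 : ∀ {v₀} → A v₀ ≡ true → ∃ λ v → A v ≡ true × degreeIn A v ≤ 1
    vertex-of-degreeIn-≤1 {v₀} Av₀ = explore n v₀ [] (m≤n+m n 1) ([] ∷ []) tt Av₀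

  degreeSumIn : (Fin n → Bool) → ℕ
  degreeSumIn A = ∑[ u < n ] (𝟙 (A u) * degreeIn A u)

  remove : (Fin n → Bool) → Fin n → Fin n → Bool
  remove A v u = A u ∧ not (does (u Finₚ.≟ v))

  𝟙-remove : ∀ {A v} → A v ≡ true → ∀ u → 𝟙 (A u) ≡ 𝟙 (remove A v u) + 𝟙 (does (u Finₚ.≟ v))
  𝟙-remove {A} {v} Av u with u Finₚ.≟ v | A u in Au
  ... | yes refl | true  = refl
  ... | yes refl | false = contradiction (trans (sym Au) Av) λ ()
  ... | no _     | true  = refl
  ... | no _     | false = refl

  count-remove : ∀ {A v} → A v ≡ true → count A ≡ count (remove A v) + 1
  count-remove {A} {v} Av = begin
    count A                                                  ≡⟨ sum-cong-≗ {n} (𝟙-remove {A} Av) ⟩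
    ∑[ u < n ] (𝟙 (remove A v u) + 𝟙 (does (u Finₚ.≟ v)))   ≡⟨ ∑-distrib-+ {n} _ _ ⟩
    count (remove A v) + count (λ u → does (u Finₚ.≟ v))     ≡⟨ cong (count (remove A v) +_) (count-singleton v) ⟩
    count (remove A v) + 1                                   ∎
    where open ≡-Reasoning

  degreeIn-remove : ∀ {A v} → A v ≡ true → ∀ u → degreeIn A u ≡ degreeIn (remove A v) u + 𝟙 (adj G u v)
  degreeIn-remove {A} {v} Av u = begin
    ∑[ w < n ] (𝟙 (A w) * e w)
      ≡⟨ sum-cong-≗ {n} (λ w → trans (cong (_* e w) (𝟙-remove {A} Av w))
                                     (*-distribʳ-+ (e w) (𝟙 (remove A v w)) _)) ⟩
    ∑[ w < n ] (𝟙 (remove A v w) * e w + 𝟙 (does (w Finₚ.≟ v)) * e w)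
      ≡⟨ ∑-distrib-+ {n} _ _ ⟩
    degreeIn (remove A v) u + ∑[ w < n ] (𝟙 (does (w Finₚ.≟ v)) * e w)
      ≡⟨ cong (degreeIn (remove A v) u +_) (∑-pick v e) ⟩
    degreeIn (remove A v) u + e v
      ∎
    where
    open ≡-Reasoning
    e = λ w → 𝟙 (adj G u w)

  degreeSumIn-remove : ∀ {A v} → A v ≡ true → degreeSumIn A ≡ degreeSumIn (remove A v) + 2 * degreeIn (remove A v) v
  degreeSumIn-remove {A} {v} Av = begin
    ∑[ u < n ] (𝟙 (A u) * degreeIn A u)
      ≡⟨ sum-cong-≗ {n} (λ u → cong₂ _*_ (𝟙-remove {A} Av u) (degreeIn-remove {A} Av u)) ⟩
    ∑[ u < n ] ((α u + δ u) * (d u + e u v))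
      ≡⟨ sum-cong-≗ {n} (λ u → expand (α u) (δ u) (d u) (e u v)) ⟩
    ∑[ u < n ] (α u * d u + α u * e u v + δ u * (d u + e u v))
      ≡⟨ ∑-distrib-+ {n} _ _ ⟩
    ∑[ u < n ] (α u * d u + α u * e u v) + ∑[ u < n ] (δ u * (d u + e u v))
      ≡⟨ cong₂ _+_ (∑-distrib-+ {n} _ _) (∑-pick v (λ u → d u + e u v)) ⟩
    degreeSumIn A′ + ∑[ u < n ] (α u * e u v) + (d v + e v v)
      ≡⟨ cong₂ (λ x y → degreeSumIn A′ + x + (d v + y))
               (sum-cong-≗ {n} (λ u → cong (λ b → α u * 𝟙 b) (Graph.sym G u v))) (cong 𝟙 (irrefl G v)) ⟩
    degreeSumIn A′ + d v + (d v + 0)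
      ≡⟨ collect (degreeSumIn A′) (d v) ⟩
    degreeSumIn A′ + 2 * d v
      ∎
    where
    open ≡-Reasoning
    A′ = remove A v
    α = λ u → 𝟙 (A′ u)
    δ = λ u → 𝟙 (does (u Finₚ.≟ v))
    d = degreeIn A′
    e = λ u w → 𝟙 (adj G u w)
    expand : ∀ a b c x → (a + b) * (c + x) ≡ a * c + a * x + b * (c + x)
    expand = solve-∀
    collect : ∀ x y → x + y + (y + 0) ≡ x + 2 * y
    collect = solve-∀

  degreeSumIn-bound : ∀ k A → count A ≡ suc k → degreeSumIn A ≤ 2 * k
  degreeSumIn-bound k A |A|≡1+k with count-witness A (subst (1 ≤_) (sym |A|≡1+k) (s≤s z≤n))
  ... | _ , Av₀ with Exploration.vertex-of-degreeIn-≤1 A Av₀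
  ... | v , Av , degree≤1 = begin
    degreeSumIn A                                           ≡⟨ degreeSumIn-remove {A} Av ⟩
    degreeSumIn (remove A v) + 2 * degreeIn (remove A v) v  ≤⟨ bound k |A′|≡k ⟩
    2 * k                                               ∎
    where
    open ≤-Reasoning
    |A′|≡k : count (remove A v) ≡ k
    |A′|≡k = suc-injective (trans (+-comm 1 _) (trans (sym (count-remove {A} Av)) |A|≡1+k))
    degree′≤1 : degreeIn (remove A v) v ≤ 1
    degree′≤1 = ≤-trans (∑-mono-≤ (λ w → *-monoˡ-≤ (𝟙 (adj G v w)) (𝟙-∧-≤ (A w) _))) degree≤1
    bound : ∀ j → count (remove A v) ≡ j → degreeSumIn (remove A v) + 2 * degreeIn (remove A v) v ≤ 2 * j
    bound zero    |A′|≡0 = ≤-reflexive (cong₂ (λ x y → x + 2 * y) (vanish _) (vanish _))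
      where
      vanish : ∀ g → ∑[ u < n ] (𝟙 (remove A v u) * g u) ≡ 0
      vanish g = ∑-vanishing (remove A v) g (count≡0⇒none _ |A′|≡0)
    bound (suc j) |A′|≡1+j = begin
      degreeSumIn (remove A v) + 2 * degreeIn (remove A v) v
        ≤⟨ +-mono-≤ (degreeSumIn-bound j _ |A′|≡1+j) (*-monoʳ-≤ 2 degree′≤1) ⟩
      2 * j + 2                                           ≡⟨ trans (+-comm (2 * j) 2) (sym (*-suc 2 j)) ⟩
      2 * suc j                                           ∎

  degree-sum : ∀ {m} → n ≡ suc m → ∑[ v < n ] degree G v ≤ 2 * m
  degree-sum {m} n≡1+m =
    subst (_≤ 2 * m) degreeSumIn-all (degreeSumIn-bound m (λ _ → true) (trans (count-all n) n≡1+m))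
    where
    degreeSumIn-all : degreeSumIn (λ _ → true) ≡ ∑[ v < n ] degree G v
    degreeSumIn-all = sum-cong-≗ {n} λ u → trans (*-identityˡ _)
                    (trans (sum-cong-≗ {n} (λ w → *-identityˡ _)) (sym (degree≡∑adj {G = G} u)))

ceil2over3-least : ∀ m {w} → 2 * m ≤ 3 * w → ceil2over3 m ≤ w
ceil2over3-least m {w} 2m≤3w = s≤s⁻¹ (m<n*o⇒m/o<n (begin-strict
  2 * m + 2         ≤⟨ +-monoˡ-≤ 2 2m≤3w ⟩
  3 * w + 2         <⟨ n<1+n _ ⟩
  suc (3 * w + 2)   ≡⟨ regroup w ⟩
  suc w * 3         ∎))
  where
  open ≤-Reasoning
  regroup : ∀ w → suc (3 * w + 2) ≡ suc w * 3
  regroup = solve-∀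

≤-ceil2over3 : ∀ m {w} → 3 * w ≤ 2 * m + 2 → w ≤ ceil2over3 m
≤-ceil2over3 m {w} 3w≤2m+2 = begin
  w              ≡⟨ m*n/n≡m w 3 ⟨
  w * 3 / 3      ≤⟨ /-monoˡ-≤ 3 (subst (_≤ 2 * m + 2) (*-comm 3 w) 3w≤2m+2) ⟩
  ceil2over3 m   ∎
  where open ≤-Reasoning

charge⇒weight-bound : ∀ {m w D ℓ d} → ℓ + d ≡ suc m → D ≤ 2 * m → 8 * suc m ≤ 3 * w + 3 * D + 2 * ℓ →
                      2 * (d + 3) ≤ 3 * w
charge⇒weight-bound {m} {w} {D} {ℓ} {d} ℓ+d≡1+m D≤2m charge = +-cancelˡ-≤ (6 * m + 2 * ℓ) _ _ (begin
  6 * m + 2 * ℓ + 2 * (d + 3)   ≡⟨ regroup m ℓ d ⟩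
  6 * m + 2 * (ℓ + d) + 6       ≡⟨ cong (λ x → 6 * m + 2 * x + 6) ℓ+d≡1+m ⟩
  6 * m + 2 * suc m + 6         ≡⟨ collect m ⟩
  8 * suc m                     ≤⟨ charge ⟩
  3 * w + 3 * D + 2 * ℓ         ≤⟨ +-monoˡ-≤ (2 * ℓ) (+-monoʳ-≤ (3 * w) (*-monoʳ-≤ 3 D≤2m)) ⟩
  3 * w + 3 * (2 * m) + 2 * ℓ   ≡⟨ reorder w m ℓ ⟩
  6 * m + 2 * ℓ + 3 * w         ∎)
  where
  open ≤-Reasoning
  regroup : ∀ m ℓ d → 6 * m + 2 * ℓ + 2 * (d + 3) ≡ 6 * m + 2 * (ℓ + d) + 6
  regroup = solve-∀
  collect : ∀ m → 6 * m + 2 * suc m + 6 ≡ 8 * suc m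
  collect = solve-∀
  reorder : ∀ w m ℓ → 3 * w + 3 * (2 * m) + 2 * ℓ ≡ 6 * m + 2 * ℓ + 3 * w
  reorder = solve-∀

acyclic-lower-bound : ∀ {n} {G : Graph n} → 1 ≤ n → Acyclic G →
                      ∀ f → IsTR2DF G f → ceil2over3 (n ∸ leaves G + 3) ≤ weight f
acyclic-lower-bound {suc m} {G} _ acyclic f isTR2DF =
  ceil2over3-least (suc m ∸ leaves G + 3)
    (charge⇒weight-bound {w = weight f} {D = ∑[ v < suc m ] degree G v} {ℓ = leaves G}
      (m+[n∸m]≡n (leaves-≤ {G = G})) (Forest.degree-sum acyclic refl) (Discharging.charge-inequality G f isTR2DF))

bound-attained⇒isγtR2 : ∀ {n} {G : Graph n} → 1 ≤ n → Acyclic G → ∀ f → IsTR2DF G f →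
                        weight f ≤ ceil2over3 (n ∸ leaves G + 3) → IsγtR2 G (ceil2over3 (n ∸ leaves G + 3))
bound-attained⇒isγtR2 1≤n acyclic f isTR2DF f≤ =
  (f , isTR2DF , ≤-antisym f≤ (acyclic-lower-bound 1≤n acyclic f isTR2DF)) , acyclic-lower-bound 1≤n acyclic

≤-ceil2over3[n∸ℓ+3] : ∀ {w k ℓ n} → 3 * w ≤ 2 * k + 8 → ℓ + k ≤ n → w ≤ ceil2over3 (n ∸ ℓ + 3)
≤-ceil2over3[n∸ℓ+3] {w} {k} {ℓ} {n} 3w≤2k+8 ℓ+k≤n = ≤-ceil2over3 (n ∸ ℓ + 3) (begin
  3 * w                 ≤⟨ 3w≤2k+8 ⟩
  2 * k + 8             ≤⟨ +-monoˡ-≤ 8 (*-monoʳ-≤ 2 k≤n∸ℓ) ⟩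
  2 * (n ∸ ℓ) + 8       ≡⟨ regroup (n ∸ ℓ) ⟩
  2 * (n ∸ ℓ + 3) + 2   ∎)
  where
  open ≤-Reasoning
  k≤n∸ℓ : k ≤ n ∸ ℓ
  k≤n∸ℓ = m+n≤o⇒m≤o∸n k (subst (_≤ n) (+-comm ℓ k) ℓ+k≤n)
  regroup : ∀ d → 2 * d + 8 ≡ 2 * (d + 3) + 2
  regroup = solve-∀

module TwoPoint {n} (a : Fin n) (x : Fin 3) (b : Fin n) (y : Fin 3) where

  label : Labelling n
  label v = if does (v Finₚ.≟ a) then x else (if does (v Finₚ.≟ b) then y else zero)

  label-a : label a ≡ x
  label-a with a Finₚ.≟ a
  ... | yes _  = refl
  ... | no a≢a = contradiction refl a≢a

  label-b : b ≢ a → label b ≡ y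
  label-b b≢a with b Finₚ.≟ a | b Finₚ.≟ b
  ... | yes b≡a | _      = contradiction b≡a b≢a
  ... | no _    | yes _  = refl
  ... | no _    | no b≢b = contradiction refl b≢b

  weight-label : weight label ≤ toℕ x + toℕ y
  weight-label = begin
    weight label
      ≡⟨ sum-allFin {n} (val label) ⟩
    ∑[ v < n ] val label v
      ≤⟨ ∑-mono-≤ below ⟩
    ∑[ v < n ] (𝟙 (does (v Finₚ.≟ a)) * toℕ x + 𝟙 (does (v Finₚ.≟ b)) * toℕ y)
      ≡⟨ ∑-distrib-+ {n} _ _ ⟩
    ∑[ v < n ] (𝟙 (does (v Finₚ.≟ a)) * toℕ x) + ∑[ v < n ] (𝟙 (does (v Finₚ.≟ b)) * toℕ y)
      ≡⟨ cong₂ _+_ (∑-pick a _) (∑-pick b _) ⟩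
    toℕ x + toℕ y
      ∎
    where
    open ≤-Reasoning
    below : ∀ v → val label v ≤ 𝟙 (does (v Finₚ.≟ a)) * toℕ x + 𝟙 (does (v Finₚ.≟ b)) * toℕ y
    below v with v Finₚ.≟ a | v Finₚ.≟ b
    ... | yes _ | _     = m≤n⇒m≤n+o _ (≤-reflexive (sym (*-identityˡ (toℕ x))))
    ... | no _  | yes _ = ≤-reflexive (sym (*-identityˡ (toℕ y)))
    ... | no _  | no _  = z≤n

two-vertex-γ : ∀ {T : Graph 2} → IsTree T → IsγtR2 T (ceil2over3 (2 ∸ leaves T + 3))
two-vertex-γ {T} (connected , acyclic) =
  bound-attained⇒isγtR2 (s≤s z≤n) acyclic (λ _ → 1F) ((λ _ ()) , supported)
    (≤-ceil2over3[n∸ℓ+3] {k = 0} {ℓ = leaves T} (m≤m+n 6 2)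
                                                (subst (_≤ 2) (sym (+-identityʳ _)) (leaves-≤ {G = T})))
  where
  supported : ∀ v → 1 ≢ 0 → Supported T (λ _ → 1F) v
  supported v _ = let u , vu = has-neighbour connected (s≤s (s≤s z≤n)) v in u , vu , λ ()

three-distinct : ∀ {m} (c : Fin (3 + m)) → ∃ λ x → ∃ λ y → x ≢ y × x ≢ c × y ≢ c
three-distinct zero          = 1F , 2F , (λ ()) , (λ ()) , (λ ())
three-distinct (suc zero)    = 0F , 2F , (λ ()) , (λ ()) , (λ ())
three-distinct (suc (suc _)) = 0F , 1F , (λ ()) , (λ ()) , (λ ())

star-γ : ∀ {n} {T : Graph n} → 2 ≤ n → IsTree T → IsStar T → IsγtR2 T (ceil2over3 (n ∸ leaves T + 3))
star-γ {suc zero}          (s≤s ())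
star-γ {suc (suc zero)}    _ tree _ = two-vertex-γ tree
star-γ {suc (suc (suc m))} {T} _ (_ , acyclic) (c , star) with three-distinct c
... | x , y , x≢y , x≢c , y≢c =
  bound-attained⇒isγtR2 (s≤s z≤n) acyclic label (dominated , supported)
    (≤-ceil2over3[n∸ℓ+3] {k = 1} {ℓ = leaves T} (≤-trans (*-monoʳ-≤ 3 weight-label) (n≤1+n 9))
                                                (leaves+1≤n {G = T} centre-inner))
  where
  open TwoPoint c 2F x 1F
  to-centre : ∀ {v} → v ≢ c → Adj T v c
  to-centre v≢c = Equivalence.from (star _ c) (inj₂ refl , v≢c)
  centre-inner : degree T c ≢ 1
  centre-inner = >⇒≢ (degree-≥2 {G = T} (Adj-sym {G = T} (to-centre x≢c)) (Adj-sym {G = T} (to-centre y≢c)) x≢y)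
  dominated : ∀ v → val label v ≡ 0 → Dominated T label v
  dominated v v↦0 with v Finₚ.≟ c
  ... | yes refl = contradiction v↦0 λ ()
  ... | no v≢c   = inj₁ (c , to-centre v≢c , cong toℕ label-a)
  supported : ∀ v → val label v ≢ 0 → Supported T label v
  supported v v↦0̸ with v Finₚ.≟ c | v Finₚ.≟ x
  ... | yes refl | _        = x , Adj-sym {G = T} (to-centre x≢c) , subst (λ l → toℕ l ≢ 0) (sym (label-b x≢c)) λ ()
  ... | no _     | yes refl = c , to-centre x≢c , subst (λ l → toℕ l ≢ 0) (sym label-a) λ ()
  ... | no _     | no _     = contradiction refl v↦0̸

double-star-γ : ∀ {n} {T : Graph n} → IsDoubleStar T → IsγtR2 T (ceil2over3 (n ∸ leaves T + 3))
double-star-γ {n} {T} ((connected , acyclic) , a , b , a≢b , inner) =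
  bound-attained⇒isγtR2 (≤-trans (s≤s z≤n) (Finₚ.toℕ<n a)) acyclic label (dominated , supported)
    (≤-ceil2over3[n∸ℓ+3] {k = 2} {ℓ = leaves T} (*-monoʳ-≤ 3 weight-label)
                                                (leaves+2≤n {G = T} a≢b a-inner b-inner))
  where
  open TwoPoint a 2F b 2F
  a-inner : degree T a ≢ 1
  a-inner = Equivalence.from (inner a) (inj₁ refl)
  b-inner : degree T b ≢ 1
  b-inner = Equivalence.from (inner b) (inj₂ refl)

  outer-leaf : ∀ {v} → v ≢ a → v ≢ b → degree T v ≡ 1
  outer-leaf {v} v≢a v≢b with degree T v ≟ 1
  ... | yes leaf = leaf
  ... | no inner-v with Equivalence.to (inner v) inner-v
  ...   | inj₁ v≡a = contradiction v≡a v≢a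
  ...   | inj₂ v≡b = contradiction v≡b v≢b

  -- If a ≁ b, the set of a and its outer neighbours is closed under adjacency, trapping the walk to b.
  a~b : Adj T a b
  a~b with adj T a b in ab
  ... | true  = refl
  ... | false with walk-closed P closed (inj₁ refl) (connected a b)
    where
    P : Fin n → Set
    P z = z ≡ a ⊎ (z ≢ a × z ≢ b × Adj T z a)
    closed : ∀ {z z′} → P z → Adj T z z′ → P z′
    closed (inj₁ refl) az′ = inj₂ ((λ z′≡a → Adj⇒≢ {G = T} az′ (sym z′≡a)) ,
                                   (λ { refl → contradiction (trans (sym ab) az′) λ () }) , Adj-sym {G = T} az′)
    closed (inj₂ (z≢a , z≢b , za)) zz′ = inj₁ (leaf-neighbour-unique {G = T} (outer-leaf z≢a z≢b) zz′ za)
  ...   | inj₁ b≡a           = contradiction (sym b≡a) a≢b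
  ...   | inj₂ (_ , b≢b , _) = contradiction refl b≢b

  -- If the neighbour u of v is outer too, {v , u} is closed under adjacency, trapping the walk to a.
  outer-attached : ∀ {v} → v ≢ a → v ≢ b → Adj T v a ⊎ Adj T v b
  outer-attached {v} v≢a v≢b with connected v a
  ... | here = contradiction refl v≢a
  ... | step {w = u} vu _ with u Finₚ.≟ a | u Finₚ.≟ b
  ...   | yes refl | _        = inj₁ vu
  ...   | no _     | yes refl = inj₂ vu
  ...   | no u≢a   | no u≢b with walk-closed P closed (inj₁ refl) (connected v a)
    where
    P : Fin n → Set
    P z = z ≡ v ⊎ z ≡ u
    closed : ∀ {z z′} → P z → Adj T z z′ → P z′
    closed (inj₁ refl) zz′ = inj₂ (leaf-neighbour-unique {G = T} (outer-leaf v≢a v≢b) zz′ vu)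
    closed (inj₂ refl) zz′ = inj₁ (leaf-neighbour-unique {G = T} (outer-leaf u≢a u≢b) zz′ (Adj-sym {G = T} vu))
  ...     | inj₁ a≡v = contradiction (sym a≡v) v≢a
  ...     | inj₂ a≡u = contradiction (sym a≡u) u≢a

  dominated : ∀ v → val label v ≡ 0 → Dominated T label v
  dominated v v↦0 with v Finₚ.≟ a | v Finₚ.≟ b
  ... | yes refl | _        = contradiction v↦0 λ ()
  ... | no _     | yes refl = contradiction v↦0 λ ()
  ... | no v≢a   | no v≢b with outer-attached v≢a v≢b
  ...   | inj₁ va = inj₁ (a , va , cong toℕ label-a)
  ...   | inj₂ vb = inj₁ (b , vb , cong toℕ (label-b (a≢b ∘ sym)))

  supported : ∀ v → val label v ≢ 0 → Supported T label v
  supported v v↦0̸ with v Finₚ.≟ a | v Finₚ.≟ b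
  ... | yes refl | _        = b , a~b , subst (λ l → toℕ l ≢ 0) (sym (label-b (a≢b ∘ sym))) λ ()
  ... | no _     | yes refl = a , Adj-sym {G = T} a~b , subst (λ l → toℕ l ≢ 0) (sym label-a) λ ()
  ... | no _     | no _     = contradiction refl v↦0̸

injective⇒surjective : ∀ {n} {σ : Fin n → Fin n} → Injective _≡_ _≡_ σ → ∀ v → ∃ λ i → σ i ≡ v
injective⇒surjective {suc m} {σ} σ-injective v with Finₚ.any? (λ i → σ i Finₚ.≟ v)
... | yes hit = hit
... | no miss = contradiction (Finₚ.injective⇒≤ squeezed-injective) (<-irrefl refl)
  where
  σ≢v : ∀ i → v ≢ σ i
  σ≢v i v≡σi = miss (i , sym v≡σi)
  squeezed : Fin (suc m) → Fin m
  squeezed i = punchOut (σ≢v i)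
  squeezed-injective : Injective _≡_ _≡_ squeezed
  squeezed-injective {i} {j} eq = σ-injective (Finₚ.punchOut-injective (σ≢v i) (σ≢v j) eq)

-- The positions labelled 0 along the path 0 — 1 — ⋯ — (n - 1) in the labelling 1 1 0 1 1 0 …:
-- all k ≡ 2 (mod 3) with k + 3 ≤ n, so that the path ends in a block of two to four 1s.
pathGap : ℕ → ℕ → Bool
pathGap n                   2                   = 5 ≤ᵇ n
pathGap (suc (suc (suc n))) (suc (suc (suc k))) = pathGap n k
pathGap _                   _                   = false

nongaps : ℕ → ℕ
nongaps n = ∑[ i < n ] 𝟙 (not (pathGap n (toℕ i)))

nongaps-bound : ∀ n → 3 * nongaps n ≤ 2 * n + 4
nongaps-bound 0 = z≤n
nongaps-bound 1 = m≤m+n 3 3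
nongaps-bound 2 = m≤m+n 6 2
nongaps-bound 3 = m≤m+n 9 1
nongaps-bound 4 = ≤-refl
nongaps-bound (suc (suc (suc (suc (suc m))))) =
  subst₂ _≤_ (regroupˡ (nongaps (2 + m))) (regroupʳ m) (+-monoʳ-≤ 6 (nongaps-bound (suc (suc m))))
  where
  regroupˡ : ∀ x → 6 + 3 * x ≡ 3 * (2 + x)
  regroupˡ = solve-∀
  regroupʳ : ∀ m → 6 + (2 * (2 + m) + 4) ≡ 2 * (5 + m) + 4
  regroupʳ = solve-∀

gap-neighbours : ∀ n k → pathGap n k ≡ true →
                 (∃ λ j → k ≡ suc j × pathGap n j ≡ false) × suc k < n × pathGap n (suc k) ≡ false
gap-neighbours n 2 gap with ≤ᵇ⇒≤ 5 n (Equivalence.from Boolₚ.T-≡ gap)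
... | s≤s (s≤s (s≤s (s≤s (s≤s _)))) = (1 , refl , refl) , s≤s (s≤s (s≤s (s≤s z≤n))) , refl
gap-neighbours (suc (suc (suc n))) (suc (suc (suc k))) gap with gap-neighbours n k gap
... | (j , refl , left) , k<n , right = (3 + j , refl , left) , s≤s (s≤s (s≤s k<n)) , right
gap-neighbours 0 (suc (suc (suc _))) ()
gap-neighbours 1 (suc (suc (suc _))) ()
gap-neighbours 2 (suc (suc (suc _))) ()

nongap-neighbour : ∀ n k → 2 ≤ n → k < n → pathGap n k ≡ false →
                   (suc k < n × pathGap n (suc k) ≡ false) ⊎ (∃ λ j → k ≡ suc j × pathGap n j ≡ false)
nongap-neighbour n 0 2≤n _ _ = inj₁ (2≤n , refl)
nongap-neighbour n 1 _   _ _ = inj₂ (0 , refl , refl)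
nongap-neighbour n 2 _   _ _ = inj₂ (1 , refl , refl)
nongap-neighbour 4 3 _   _ _ = inj₂ (2 , refl , refl)
nongap-neighbour (suc (suc (suc (suc (suc n))))) (suc (suc (suc k))) _ (s≤s (s≤s (s≤s k<2+n))) nongap
  with nongap-neighbour (suc (suc n)) k (s≤s (s≤s z≤n)) k<2+n nongap
... | inj₁ (1+k<2+n , right) = inj₁ (s≤s (s≤s (s≤s 1+k<2+n)) , right)
... | inj₂ (j , refl , left) = inj₂ (3 + j , refl , left)
nongap-neighbour 1 (suc (suc (suc _)))       _ (s≤s ()) _
nongap-neighbour 2 (suc (suc (suc _)))       _ (s≤s (s≤s ())) _
nongap-neighbour 3 (suc (suc (suc _)))       _ (s≤s (s≤s (s≤s ()))) _
nongap-neighbour 4 (suc (suc (suc (suc _)))) _ (s≤s (s≤s (s≤s (s≤s ())))) _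

gapLabel : Bool → Fin 3
gapLabel true  = 0F
gapLabel false = 1F

val-gapLabel : ∀ b → toℕ (gapLabel b) ≡ 𝟙 (not b)
val-gapLabel true  = refl
val-gapLabel false = refl

module PathLabelling {m} {T : Graph (2 + m)} (σ : Fin (2 + m) → Fin (2 + m)) (σ-injective : Injective _≡_ _≡_ σ)
  (σ-adj : ∀ i j → Adj T (σ i) (σ j) ⇔ (suc (toℕ i) ≡ toℕ j ⊎ suc (toℕ j) ≡ toℕ i)) where

  n : ℕ
  n = 2 + m

  τ : Fin n → Fin n
  τ v = proj₁ (injective⇒surjective σ-injective v)

  στ : ∀ v → σ (τ v) ≡ v
  στ v = proj₂ (injective⇒surjective σ-injective v)

  τσ : ∀ i → τ (σ i) ≡ i
  τσ i = σ-injective (στ (σ i))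

  left : ∀ i {k} → toℕ i ≡ suc k → ∃ λ j → toℕ j ≡ k × Adj T (σ i) (σ j)
  left i {k} i≡1+k = fromℕ< k<n , Finₚ.toℕ-fromℕ< k<n ,
                     Equivalence.from (σ-adj i _) (inj₂ (trans (cong suc (Finₚ.toℕ-fromℕ< k<n)) (sym i≡1+k)))
    where
    k<n : k < n
    k<n = <-trans (n<1+n k) (subst (_< n) i≡1+k (Finₚ.toℕ<n i))

  right : ∀ i → suc (toℕ i) < n → ∃ λ j → toℕ j ≡ suc (toℕ i) × Adj T (σ i) (σ j)
  right i 1+i<n = fromℕ< 1+i<n , Finₚ.toℕ-fromℕ< 1+i<n ,
                  Equivalence.from (σ-adj i _) (inj₁ (sym (Finₚ.toℕ-fromℕ< 1+i<n)))

  two-apart : ∀ {i j₁ j₂ : Fin n} {k} → toℕ i ≡ suc k → toℕ j₁ ≡ k → toℕ j₂ ≡ suc (toℕ i) →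
              σ j₁ ≢ σ j₂
  two-apart {k = k} i≡1+k j₁≡k j₂≡1+i σj₁≡σj₂ = m≢1+n+m k {1}
    (trans (sym j₁≡k) (trans (cong toℕ (σ-injective σj₁≡σj₂)) (trans j₂≡1+i (cong suc i≡1+k))))

  from-σ : ∀ {v i} → Adj T (σ (τ v)) (σ i) → Adj T v (σ i)
  from-σ {v} {i} = subst (λ u → Adj T u (σ i)) (στ v)

  label : Labelling n
  label v = gapLabel (pathGap n (toℕ (τ v)))

  val-label-σ : ∀ i → val label (σ i) ≡ 𝟙 (not (pathGap n (toℕ i)))
  val-label-σ i = trans (cong (λ j → toℕ (gapLabel (pathGap n (toℕ j)))) (τσ i)) (val-gapLabel _)

  labelled-1 : ∀ {i} → pathGap n (toℕ i) ≡ false → val label (σ i) ≡ 1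
  labelled-1 {i} nongap = trans (val-label-σ i) (cong (𝟙 ∘ not) nongap)

  dominated : ∀ v → val label v ≡ 0 → Dominated T label v
  dominated v v↦0 with gap-neighbours n (toℕ (τ v)) (gap (pathGap n (toℕ (τ v))) v↦0)
    where
    gap : ∀ b → toℕ (gapLabel b) ≡ 0 → b ≡ true
    gap true _ = refl
  ... | (k , τv≡1+k , left-nongap) , 1+τv<n , right-nongap with left (τ v) τv≡1+k | right (τ v) 1+τv<n
  ... | j₁ , j₁≡k , τv~j₁ | j₂ , j₂≡1+τv , τv~j₂ =
    inj₂ (σ j₁ , σ j₂ , two-apart τv≡1+k j₁≡k j₂≡1+τv , from-σ τv~j₁ , from-σ τv~j₂ ,
          labelled-1 (trans (cong (pathGap n) j₁≡k) left-nongap) ,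
          labelled-1 (trans (cong (pathGap n) j₂≡1+τv) right-nongap))

  supported : ∀ v → val label v ≢ 0 → Supported T label v
  supported v v↦0̸ with nongap-neighbour n (toℕ (τ v)) (s≤s (s≤s z≤n)) (Finₚ.toℕ<n (τ v))
                                        (nongap (pathGap n (toℕ (τ v))) v↦0̸)
    where
    nongap : ∀ b → toℕ (gapLabel b) ≢ 0 → b ≡ false
    nongap true  ↦0̸ = contradiction refl ↦0̸
    nongap false _  = refl
  ... | inj₁ (1+τv<n , right-nongap) with right (τ v) 1+τv<n
  ...   | j , j≡1+τv , τv~j =
    σ j , from-σ τv~j , subst (_≢ 0) (sym (labelled-1 (trans (cong (pathGap n) j≡1+τv) right-nongap))) λ ()
  supported v v↦0̸ | inj₂ (k , τv≡1+k , left-nongap) with left (τ v) τv≡1+k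
  ...   | j , j≡k , τv~j =
    σ j , from-σ τv~j , subst (_≢ 0) (sym (labelled-1 (trans (cong (pathGap n) j≡k) left-nongap))) λ ()

  weight-label : weight label ≡ nongaps n
  weight-label = begin
    weight label                 ≡⟨ sum-allFin {n} (val label) ⟩
    ∑[ v < n ] val label v       ≡⟨ ∑-permute (val label) (permutation σ τ στ τσ) ⟩
    ∑[ i < n ] val label (σ i)   ≡⟨ sum-cong-≗ {n} val-label-σ ⟩
    nongaps n                    ∎
    where open ≡-Reasoning

  end-index : ∀ i → isLeafᵇ (degree T (σ i)) ≡ true → toℕ i ≡ 0 ⊎ suc (toℕ i) ≡ n
  end-index i leaf with toℕ i in i≡ | suc (toℕ i) ≟ n
  ... | zero  | _          = inj₁ refl
  ... | suc k | yes 1+i≡n = inj₂ 1+i≡n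
  ... | suc k | no 1+i≢n
    with left i i≡ | right i (≤∧≢⇒< (Finₚ.toℕ<n i) (subst (λ t → suc t ≢ n) (sym i≡) 1+i≢n))
  ...   | j₁ , j₁≡k , i~j₁ | j₂ , j₂≡1+i , i~j₂ =
    contradiction (trans (sym (isLeafᵇ-≢1 (>⇒≢ inner))) leaf) λ ()
    where
    inner : 2 ≤ degree T (σ i)
    inner = degree-≥2 {G = T} i~j₁ i~j₂ (two-apart i≡ j₁≡k j₂≡1+i)

  leaves-≤2 : leaves T ≤ 2
  leaves-≤2 = subst (_≤ 2) (sym (countFin≡count {n} (isLeafᵇ ∘ degree T)))
                (count-≤-2 (isLeafᵇ ∘ degree T) (σ 0F) (σ (fromℕ (suc m))) ends)
    where
    ends : ∀ {v} → isLeafᵇ (degree T v) ≡ true → v ≡ σ 0F ⊎ v ≡ σ (fromℕ (suc m))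
    ends {v} leaf with end-index (τ v) (subst (λ u → isLeafᵇ (degree T u) ≡ true) (sym (στ v)) leaf)
    ... | inj₁ τv≡0   = inj₁ (trans (sym (στ v)) (cong σ (Finₚ.toℕ-injective τv≡0)))
    ... | inj₂ 1+τv≡n = inj₂ (trans (sym (στ v)) (cong σ (Finₚ.toℕ-injective
                          (trans (suc-injective 1+τv≡n) (sym (Finₚ.toℕ-fromℕ (suc m)))))))

path-γ : ∀ {n} {T : Graph n} → 2 ≤ n → IsTree T → IsPath T → IsγtR2 T (ceil2over3 (n ∸ leaves T + 3))
path-γ {suc zero} (s≤s ())
path-γ {suc (suc m)} {T} _ (_ , acyclic) (σ , σ-injective , σ-adj) =
  bound-attained⇒isγtR2 (s≤s z≤n) acyclic label (dominated , supported)
    (≤-ceil2over3[n∸ℓ+3] {k = m} {ℓ = leaves T}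
      (subst₂ _≤_ (cong (3 *_) (sym weight-label)) (regroup m) (nongaps-bound (2 + m))) (+-monoˡ-≤ m leaves-≤2))
  where
  open PathLabelling {T = T} σ σ-injective σ-adj
  regroup : ∀ m → 2 * (2 + m) + 4 ≡ 2 * m + 8
  regroup = solve-∀

mainTheorem16 : ∀ (n : ℕ) (T : Graph n) → 2 ≤ n → IsTree T →
    (∀ f → IsTR2DF T f → ceil2over3 (n ∸ leaves T + 3) ≤ weight f)
    × ((IsPath T ⊎ IsStar T ⊎ IsDoubleStar T) → IsγtR2 T (ceil2over3 (n ∸ leaves T + 3)))
mainTheorem16 n T 2≤n tree@(_ , acyclic) =
  acyclic-lower-bound (≤-trans (s≤s z≤n) 2≤n) acyclic , [ path-γ 2≤n tree , [ star-γ 2≤n tree , double-star-γ ] ]
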